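{- Let $d$ be a non-negative integer, $e=2^d$, and $\nu$ a suitable tuple of length $e$. Then one of the following holds: (1) the subspace $\mathbb{P}=\{v\in\mathbb{F}_2^e: v_e=0\}$ is invariant under $M_d^\nu$, and a vector $w$ is even if and only if $M_d^\nu w$ is even; or (2) $M_d^\nu$ maps $\mathbb{P}$ bijectively onto $\{(v_1,\dots,v_e)\in\mathbb{F}_2^e: v_1=0\}$, and a vector $w$ is even if and only if $M_d^\nu w$ has a zero in its first coordinate.
   Context: A vector in $\mathbb{F}_2^e$ is even if its last entry is $0$. Define $M_0=(1)$ and $M_{d+1}=\begin{pmatrix}M_d&M_d\\0&M_d\end{pmatrix}$ over $\mathbb{F}_2$, so $M_d$ is $e\times e$. Let $\sigma$ act on a column vector by $\sigma(c_1,\dots,c_e)=(c_e,c_1,\dots,c_{e-1})$. A tuple $\nu=(n_1,\dots,n_e)$ of non-negative integers is suitable if $n_e=0$ and $n_{i+1}\le n_i\le n_{i+1}+1$ for $1\le i\le e-1$. With $C_1,\dots,C_e$ the columns of $M_d$, $M_d^\nu=(\sigma^{n_1}(C_1),\dots,\sigma^{n_e}(C_e))$. -}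

module Defs where

open import Data.Nat using (ℕ; zero; suc; _+_; _^_; _≤_)
open import Data.Nat.Properties using (+-identityʳ)
open import Data.Bool using (Bool; true; false; _∧_; _xor_)
open import Data.Fin using (Fin; zero; suc; fromℕ; inject₁; splitAt; cast)
open import Data.Sum using (inj₁; inj₂)
open import Data.Product using (_×_)
open import Data.Unit using (⊤)
open import Relation.Binary.PropositionalEquality using (_≡_; cong)

-- F₂ is modelled by Bool (false = 0, true = 1, xor = +, ∧ = ·).
-- Vectors in F₂^n are functions Fin n → Bool; index zero is the first entry.
-- Matrices are functions (row : Fin n) → (column : Fin n) → Bool.

Vec₂ : ℕ → Set
Vec₂ n = Fin n → Bool

Mat₂ : ℕ → Set
Mat₂ n = Fin n → Fin n → Bool

sum₂ : ∀ {n} → Vec₂ n → Bool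
sum₂ {zero} v = false
sum₂ {suc n} v = v zero xor sum₂ (λ i → v (suc i))

_·_ : ∀ {n} → Mat₂ n → Vec₂ n → Vec₂ n
(A · w) i = sum₂ (λ j → A i j ∧ w j)

block : ∀ {m} → Mat₂ m → Mat₂ (m + m)
block {m} A i j with splitAt m i | splitAt m j
... | inj₁ i' | inj₁ j' = A i' j'
... | inj₁ i' | inj₂ j' = A i' j'
... | inj₂ i' | inj₁ j' = false
... | inj₂ i' | inj₂ j' = A i' j'

-- 2 ^ suc d  reduces to  2 ^ d + (2 ^ d + 0)
fix : ∀ d → Fin (2 ^ suc d) → Fin (2 ^ d + 2 ^ d)
fix d = cast (cong (2 ^ d +_) (+-identityʳ (2 ^ d)))

M : (d : ℕ) → Mat₂ (2 ^ d)
M zero i j = true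
M (suc d) i j = block (M d) (fix d i) (fix d j)

σ : ∀ {n} → Vec₂ n → Vec₂ n
σ {zero} c = c
σ {suc n} c zero = c (fromℕ n)
σ {suc n} c (suc i) = c (inject₁ i)

σ^ : ∀ {n} → ℕ → Vec₂ n → Vec₂ n
σ^ zero c = c
σ^ (suc k) c = σ (σ^ k c)

col : ∀ {n} → Mat₂ n → Fin n → Vec₂ n
col A j i = A i j

Mν : (d : ℕ) → (Fin (2 ^ d) → ℕ) → Mat₂ (2 ^ d)
Mν d ν i j = σ^ (ν j) (col (M d) j) i

Suitable : ∀ {n} → (Fin n → ℕ) → Set
Suitable {zero} ν = ⊤
Suitable {suc n} ν =
  (ν (fromℕ n) ≡ 0) ×
  (∀ (i : Fin n) → (ν (suc i) ≤ ν (inject₁ i)) × (ν (inject₁ i) ≤ suc (ν (suc i))))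

Even : ∀ {n} → Vec₂ n → Set
Even {zero} v = ⊤
Even {suc n} v = v (fromℕ n) ≡ false

FirstZero : ∀ {n} → Vec₂ n → Set
FirstZero {zero} v = ⊤
FirstZero {suc n} v = v zero ≡ false

_≈_ : ∀ {n} → Vec₂ n → Vec₂ n → Set
u ≈ v = ∀ i → u i ≡ v i

{-# OPTIONS --safe #-}
module Submission where

-- Write D = 1 + σ and index from 0. By Pascal's rule mod 2 the columns of M_d are D^j e₀, and the last one,
-- D^(e-1) e₀, is all ones; both facts survive the doubling M_d ↦ M_(d+1) because D^e = 1 + σ^e.
-- So column j of M_d^ν is σ^(ν_j) D^j e₀, supported on the window [ν_j, ν_j + j]. Suitability forces the
-- penultimate entry of ν to be 0 or 1. If it is 0, every window but the last misses the last row, so the last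
-- entry of M_d^ν w is the last entry of w; if it is 1, every such window misses the first row, so the first
-- entry of M_d^ν w is the last entry of w. In the second case M_d^ν is moreover invertible: D^c sends column j
-- to 𝟙 when c + j = e - 1 and to 𝟘 when c + j ≥ e, so the matrix is triangular with respect to the flag
-- ker D ⊂ ker D² ⊂ ⋯ ⊂ ker D^e = F₂^e.

open import Defs
open import Level using (0ℓ)
open import Algebra.Bundles using (CommutativeRing)
open import Data.Nat using (ℕ; zero; suc; _+_; _∸_; _^_; _≤_; _<_; s≤s; s≤s⁻¹; pred)
open import Data.Nat.Properties
  using (≤-refl; ≤-reflexive; ≤-trans; <-irrefl; <-cmp; <⇒≤; <-≤-trans; ≤∧≢⇒<; n≤1+n; m<n⇒m<1+n; suc-injective;
         +-comm; +-suc; +-identityʳ; m≤m+n; +-monoˡ-≤; +-monoʳ-<; m∸n≤m; m∸n+n≡m; m+[n∸m]≡n)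
open import Data.Bool using (Bool; true; false; _∧_; _xor_)
open import Data.Bool.Properties
  using (xor-same; xor-identityʳ; ∧-zeroʳ; ∧-identityʳ; ∧-distribˡ-xor; ∧-distribʳ-xor; xor-∧-commutativeRing)
open import Data.Fin using (Fin; zero; suc; toℕ; fromℕ; fromℕ<; inject₁; lower₁; splitAt; join; _↑ˡ_; _↑ʳ_; cast)
open import Data.Fin.Properties
  using (toℕ-injective; toℕ-fromℕ; toℕ-fromℕ<; toℕ-inject₁; toℕ≤pred[n]; toℕ-lower₁; inject₁-lower₁; inject₁-injective;
         fromℕ≢inject₁; toℕ-↑ˡ; toℕ-↑ʳ; splitAt-↑ˡ; splitAt-↑ʳ; join-splitAt; cast-is-id)
  renaming (_≟_ to _≟ᶠ_; suc-injective to finSuc-injective)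
open import Data.Fin.Induction using (<-wellFounded)
open import Data.Vec.Functional using (_++_)
open import Data.Vec.Functional.Properties using (lookup-++ˡ; lookup-++ʳ; ++-cong)
open import Data.Sum using (_⊎_; inj₁; inj₂; [_,_])
open import Data.Product using (_×_; _,_; Σ; proj₁; proj₂)
open import Data.Unit using (tt)
open import Data.Empty using (⊥-elim)
open import Function using (_∘_)
open import Function.Bundles using (_⇔_; mk⇔)
open import Induction.WellFounded using (module All)
open import Relation.Nullary using (does; yes; no)
open import Relation.Nullary.Decidable using (dec-true; dec-false)
open import Relation.Binary.Definitions using (tri<; tri≈; tri>)
open import Relation.Binary.PropositionalEquality
import Relation.Binary.Reasoning.Setoid as SetoidReasoning

open CommutativeRing xor-∧-commutativeRing using () renaming (+-commutativeSemigroup to xor-commutativeSemigroup)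
open import Algebra.Properties.CommutativeSemigroup xor-commutativeSemigroup using (interchange)

module ≈-Reasoning {n : ℕ} = SetoidReasoning (Fin n →-setoid Bool)

xor≡false⇒≡ : ∀ a b → a xor b ≡ false → a ≡ b
xor≡false⇒≡ false false _ = refl
xor≡false⇒≡ true  true  _ = refl

xor-cancelʳ : ∀ a b → (a xor b) xor b ≡ a
xor-cancelʳ a false = trans (xor-identityʳ (a xor false)) (xor-identityʳ a)
xor-cancelʳ false true = refl
xor-cancelʳ true  true = refl

infixl 30 _⊕_

_⊕_ : ∀ {n} → Vec₂ n → Vec₂ n → Vec₂ n
(u ⊕ v) i = u i xor v i

𝟘 𝟙 : ∀ {n} → Vec₂ n
𝟘 _ = false
𝟙 _ = true

e₀ : ∀ {n} → Vec₂ n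
e₀ zero    = true
e₀ (suc _) = false

unit : ∀ {n} → Fin n → Vec₂ n
unit i j = does (i ≟ᶠ j)

≈-refl : ∀ {n} {u : Vec₂ n} → u ≈ u
≈-refl _ = refl

≈-sym : ∀ {n} {u v : Vec₂ n} → u ≈ v → v ≈ u
≈-sym p i = sym (p i)

≈-trans : ∀ {n} {u v w : Vec₂ n} → u ≈ v → v ≈ w → u ≈ w
≈-trans p q i = trans (p i) (q i)

⊕-cong : ∀ {n} {u u′ v v′ : Vec₂ n} → u ≈ u′ → v ≈ v′ → u ⊕ v ≈ u′ ⊕ v′
⊕-cong p q i = cong₂ _xor_ (p i) (q i)

⊕-interchange : ∀ {n} (u v u′ v′ : Vec₂ n) → (u ⊕ v) ⊕ (u′ ⊕ v′) ≈ (u ⊕ u′) ⊕ (v ⊕ v′)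
⊕-interchange u v u′ v′ i = interchange (u i) (v i) (u′ i) (v′ i)

⊕-self : ∀ {n} (u : Vec₂ n) → u ⊕ u ≈ 𝟘
⊕-self u i = xor-same (u i)

sum₂-cong : ∀ {n} {u v : Vec₂ n} → u ≈ v → sum₂ u ≡ sum₂ v
sum₂-cong {zero}  p = refl
sum₂-cong {suc n} p = cong₂ _xor_ (p zero) (sum₂-cong (p ∘ suc))

sum₂-⊕ : ∀ {n} (u v : Vec₂ n) → sum₂ (u ⊕ v) ≡ sum₂ u xor sum₂ v
sum₂-⊕ {zero}  u v = refl
sum₂-⊕ {suc n} u v = trans (cong ((u zero xor v zero) xor_) (sum₂-⊕ (u ∘ suc) (v ∘ suc)))
                           (interchange (u zero) (v zero) _ _)

sum₂-𝟘 : ∀ {n} {u : Vec₂ n} → u ≈ 𝟘 → sum₂ u ≡ false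
sum₂-𝟘 {n} p = trans (sum₂-cong p) (sum₂-zero {n})
  where
  sum₂-zero : ∀ {n} → sum₂ {n} 𝟘 ≡ false
  sum₂-zero {zero}  = refl
  sum₂-zero {suc n} = sum₂-zero {n}

sum₂-single : ∀ {n} (u : Vec₂ n) j → (∀ i → i ≢ j → u i ≡ false) → sum₂ u ≡ u j
sum₂-single u zero    p = trans (cong (u zero xor_) (sum₂-𝟘 (λ i → p (suc i) λ ()))) (xor-identityʳ (u zero))
sum₂-single u (suc j) p =
  cong₂ _xor_ (p zero λ ()) (sum₂-single (u ∘ suc) j (λ i i≢j → p (suc i) (i≢j ∘ finSuc-injective)))

σ-cong : ∀ {n} {u v : Vec₂ n} → u ≈ v → σ u ≈ σ v
σ-cong {zero}  p i       = p i
σ-cong {suc n} p zero    = p (fromℕ n)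
σ-cong {suc n} p (suc i) = p (inject₁ i)

σ-⊕ : ∀ {n} (u v : Vec₂ n) → σ (u ⊕ v) ≈ σ u ⊕ σ v
σ-⊕ {zero}  u v i       = refl
σ-⊕ {suc n} u v zero    = refl
σ-⊕ {suc n} u v (suc i) = refl

σ-𝟙 : ∀ {n} → σ {n} 𝟙 ≈ 𝟙
σ-𝟙 {zero}  i       = refl
σ-𝟙 {suc n} zero    = refl
σ-𝟙 {suc n} (suc i) = refl

σ-𝟘 : ∀ {n} → σ {n} 𝟘 ≈ 𝟘
σ-𝟘 {zero}  i       = refl
σ-𝟘 {suc n} zero    = refl
σ-𝟘 {suc n} (suc i) = refl

σ^-cong : ∀ {n} t {u v : Vec₂ n} → u ≈ v → σ^ t u ≈ σ^ t v
σ^-cong zero    p = p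
σ^-cong (suc t) p = σ-cong (σ^-cong t p)

σ^-𝟙 : ∀ {n} t → σ^ {n} t 𝟙 ≈ 𝟙
σ^-𝟙 zero    = ≈-refl
σ^-𝟙 (suc t) = ≈-trans (σ-cong (σ^-𝟙 t)) σ-𝟙

σ^-𝟘 : ∀ {n} t → σ^ {n} t 𝟘 ≈ 𝟘
σ^-𝟘 zero    = ≈-refl
σ^-𝟘 (suc t) = ≈-trans (σ-cong (σ^-𝟘 t)) σ-𝟘

D : ∀ {n} → Vec₂ n → Vec₂ n
D v = v ⊕ σ v

D^ : ∀ {n} → ℕ → Vec₂ n → Vec₂ n
D^ zero    v = v
D^ (suc t) v = D (D^ t v)

D-cong : ∀ {n} {u v : Vec₂ n} → u ≈ v → D u ≈ D v
D-cong p = ⊕-cong p (σ-cong p)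

D^-cong : ∀ {n} t {u v : Vec₂ n} → u ≈ v → D^ t u ≈ D^ t v
D^-cong zero    p = p
D^-cong (suc t) p = D-cong (D^-cong t p)

D-⊕ : ∀ {n} (u v : Vec₂ n) → D (u ⊕ v) ≈ D u ⊕ D v
D-⊕ u v = ≈-trans (⊕-cong {u = u ⊕ v} ≈-refl (σ-⊕ u v)) (⊕-interchange u v (σ u) (σ v))

D^-⊕ : ∀ {n} t (u v : Vec₂ n) → D^ t (u ⊕ v) ≈ D^ t u ⊕ D^ t v
D^-⊕ zero    u v = ≈-refl
D^-⊕ (suc t) u v = ≈-trans (D-cong (D^-⊕ t u v)) (D-⊕ (D^ t u) (D^ t v))

D-𝟙 : ∀ {n} → D {n} 𝟙 ≈ 𝟘
D-𝟙 i = cong (true xor_) (σ-𝟙 i)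

D^-𝟘 : ∀ {n} t → D^ {n} t 𝟘 ≈ 𝟘
D^-𝟘 zero    = ≈-refl
D^-𝟘 (suc t) = ≈-trans (D-cong (D^-𝟘 t)) σ-𝟘

D^-+ : ∀ {n} c t (v : Vec₂ n) → D^ c (D^ t v) ≡ D^ (c + t) v
D^-+ zero    t v = refl
D^-+ (suc c) t v = cong D (D^-+ c t v)

D-σ^ : ∀ {n} t (v : Vec₂ n) → D (σ^ t v) ≈ σ^ t (D v)
D-σ^ zero    v = ≈-refl
D-σ^ (suc t) v = ≈-trans (≈-sym (σ-⊕ (σ^ t v) (σ (σ^ t v)))) (σ-cong (D-σ^ t v))

D^-σ^ : ∀ {n} c t (v : Vec₂ n) → D^ c (σ^ t v) ≈ σ^ t (D^ c v)
D^-σ^ zero    t v = ≈-refl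
D^-σ^ (suc c) t v = ≈-trans (D-cong (D^-σ^ c t v)) (D-σ^ t (D^ c v))

D-kernel-constant : ∀ {k} (v : Vec₂ (suc k)) → D v ≈ 𝟘 → ∀ i → v i ≡ v zero
D-kernel-constant v Dv≈𝟘 i = go (toℕ i) i refl
  where
  go : ∀ t i → toℕ i ≡ t → v i ≡ v zero
  go zero    zero    _ = refl
  go (suc t) (suc i) e =
    trans (xor≡false⇒≡ _ _ (Dv≈𝟘 (suc i))) (go t (inject₁ i) (trans (toℕ-inject₁ i) (suc-injective e)))

mapCols : ∀ {n} → (Vec₂ n → Vec₂ n) → Mat₂ n → Mat₂ n
mapCols f A i j = f (col A j) i

·-cong : ∀ {n} {A B : Mat₂ n} (w : Vec₂ n) → (∀ j → col A j ≈ col B j) → (A · w) ≈ (B · w)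
·-cong w p i = sum₂-cong (λ j → cong (_∧ w j) (p j i))

·-⊕ : ∀ {n} (A : Mat₂ n) (u v : Vec₂ n) → (A · (u ⊕ v)) ≈ (A · u) ⊕ (A · v)
·-⊕ A u v i = trans (sum₂-cong (λ j → ∧-distribˡ-xor (A i j) (u j) (v j)))
                    (sum₂-⊕ (λ j → A i j ∧ u j) (λ j → A i j ∧ v j))

·-𝟘 : ∀ {n} (A : Mat₂ n) → (A · 𝟘) ≈ 𝟘
·-𝟘 A i = sum₂-𝟘 (λ j → ∧-zeroʳ (A i j))

·-unit : ∀ {n} (A : Mat₂ n) j → (A · unit j) ≈ col A j
·-unit A j i =
  trans (sum₂-single _ j off-j) (trans (cong (A i j ∧_) (dec-true (j ≟ᶠ j) refl)) (∧-identityʳ (A i j)))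
  where
  off-j : ∀ j′ → j′ ≢ j → A i j′ ∧ unit j j′ ≡ false
  off-j j′ j′≢j = trans (cong (A i j′ ∧_) (dec-false (j ≟ᶠ j′) (j′≢j ∘ sym))) (∧-zeroʳ (A i j′))

σ-· : ∀ {n} (A : Mat₂ n) w → σ (A · w) ≈ (mapCols σ A · w)
σ-· {zero}  A w i       = refl
σ-· {suc n} A w zero    = refl
σ-· {suc n} A w (suc i) = refl

D-· : ∀ {n} (A : Mat₂ n) w → D (A · w) ≈ (mapCols D A · w)
D-· A w i = trans (cong ((A · w) i xor_) (σ-· A w i))
  (trans (sym (sum₂-⊕ (λ j → A i j ∧ w j) (λ j → σ (col A j) i ∧ w j)))
         (sum₂-cong (λ j → sym (∧-distribʳ-xor (w j) (A i j) (σ (col A j) i)))))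

D^-· : ∀ {n} t (A : Mat₂ n) w → D^ t (A · w) ≈ (mapCols (D^ t) A · w)
D^-· zero    A w = ≈-refl
D^-· (suc t) A w = ≈-trans (D-cong (D^-· t A w)) (D-· (mapCols (D^ t) A) w)

VanishesOutside : ∀ {n} → Vec₂ n → ℕ → ℕ → Set
VanishesOutside v lo hi = ∀ i → toℕ i < lo ⊎ hi < toℕ i → v i ≡ false

σ-vanishes : ∀ {k lo hi} {v : Vec₂ (suc k)} → VanishesOutside v lo hi → hi < k →
             VanishesOutside (σ v) (suc lo) (suc hi)
σ-vanishes {k} p hi<k zero    _                = p (fromℕ k) (inj₂ (subst (_ <_) (sym (toℕ-fromℕ k)) hi<k))
σ-vanishes     p hi<k (suc i) (inj₁ (s≤s i<lo)) = p (inject₁ i) (inj₁ (subst (_< _) (sym (toℕ-inject₁ i)) i<lo))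
σ-vanishes     p hi<k (suc i) (inj₂ (s≤s hi<i)) = p (inject₁ i) (inj₂ (subst (_ <_) (sym (toℕ-inject₁ i)) hi<i))

σ^-vanishes : ∀ {k lo hi} {v : Vec₂ (suc k)} → VanishesOutside v lo hi →
              ∀ t → t + hi ≤ k → VanishesOutside (σ^ t v) (t + lo) (t + hi)
σ^-vanishes p zero    _ = p
σ^-vanishes p (suc t) h = σ-vanishes (σ^-vanishes p t (≤-trans (n≤1+n _) h)) h

D^-e₀-vanishes : ∀ {n} t → VanishesOutside (D^ t (e₀ {n})) 0 t
D^-e₀-vanishes zero    (suc i) (inj₂ _)            = refl
D^-e₀-vanishes (suc t) (suc i) (inj₂ (s≤s t<i)) =
  cong₂ _xor_ (D^-e₀-vanishes t (suc i) (inj₂ (m<n⇒m<1+n t<i)))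
              (D^-e₀-vanishes t (inject₁ i) (inj₂ (subst (t <_) (sym (toℕ-inject₁ i)) t<i)))

++-ind : ∀ {m n} (P : Fin (m + n) → Set) → (∀ i → P (i ↑ˡ n)) → (∀ j → P (m ↑ʳ j)) → ∀ k → P k
++-ind {m} {n} P left right k = subst P (join-splitAt m n k) ([_,_] {C = P ∘ join m n} left right (splitAt m k))

++-cases : ∀ {m n} (P : Fin (suc m + suc n) → Set) →
           P zero → (∀ i → P (suc i ↑ˡ suc n)) → P (suc m ↑ʳ zero) → (∀ j → P (suc m ↑ʳ suc j)) → ∀ k → P k
++-cases {m} {n} P p₀ pˡ pₘ pʳ = ++-ind P left right
  where
  left : ∀ i → P (i ↑ˡ suc n)
  left zero    = p₀
  left (suc i) = pˡ i
  right : ∀ j → P (suc m ↑ʳ j)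
  right zero    = pₘ
  right (suc j) = pʳ j

++-⊕ : ∀ {m n} (u u′ : Vec₂ m) (v v′ : Vec₂ n) → (u ++ v) ⊕ (u′ ++ v′) ≈ ((u ⊕ u′) ++ (v ⊕ v′))
++-⊕ {m} u u′ v v′ i with splitAt m i
... | inj₁ _ = refl
... | inj₂ _ = refl

𝟙++𝟙 : ∀ {m n} → (𝟙 {m} ++ 𝟙 {n}) ≈ 𝟙
𝟙++𝟙 {m} i with splitAt m i
... | inj₁ _ = refl
... | inj₂ _ = refl

module _ {m n} (u : Vec₂ (suc m)) (v : Vec₂ (suc n)) where

  σ-++-zero : σ (u ++ v) zero ≡ v (fromℕ n)
  σ-++-zero = trans (cong (u ++ v) last≡) (lookup-++ʳ u v (fromℕ n))
    where
    last≡ : fromℕ (m + suc n) ≡ suc m ↑ʳ fromℕ n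
    last≡ = toℕ-injective (trans (toℕ-fromℕ _)
              (trans (+-suc m n) (sym (trans (toℕ-↑ʳ (suc m) (fromℕ n)) (cong (suc m +_) (toℕ-fromℕ n))))))

  σ-++-middle : σ (u ++ v) (suc m ↑ʳ zero) ≡ u (fromℕ m)
  σ-++-middle = trans (cong (u ++ v) middle≡) (lookup-++ˡ u v (fromℕ m))
    where
    middle≡ : inject₁ (m ↑ʳ zero {n}) ≡ fromℕ m ↑ˡ suc n
    middle≡ = toℕ-injective (trans (toℕ-inject₁ (m ↑ʳ zero))
                (trans (toℕ-↑ʳ m zero) (trans (+-identityʳ m)
                  (sym (trans (toℕ-↑ˡ (fromℕ m) (suc n)) (toℕ-fromℕ m))))))

  σ-++ˡ : ∀ i → σ (u ++ v) (suc i ↑ˡ suc n) ≡ σ u (suc i)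
  σ-++ˡ i = trans (cong (u ++ v) inject≡) (lookup-++ˡ u v (inject₁ i))
    where
    inject≡ : inject₁ (i ↑ˡ suc n) ≡ inject₁ i ↑ˡ suc n
    inject≡ = toℕ-injective (trans (toℕ-inject₁ (i ↑ˡ suc n))
                (trans (toℕ-↑ˡ i (suc n)) (sym (trans (toℕ-↑ˡ (inject₁ i) (suc n)) (toℕ-inject₁ i)))))

  σ-++ʳ : ∀ j → σ (u ++ v) (suc m ↑ʳ suc j) ≡ σ v (suc j)
  σ-++ʳ j = trans (cong (u ++ v) inject≡) (lookup-++ʳ u v (inject₁ j))
    where
    inject≡ : inject₁ (m ↑ʳ suc j) ≡ suc m ↑ʳ inject₁ j
    inject≡ = toℕ-injective (trans (toℕ-inject₁ (m ↑ʳ suc j))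
                (trans (toℕ-↑ʳ m (suc j)) (trans (+-suc m (toℕ j))
                  (sym (trans (toℕ-↑ʳ (suc m) (inject₁ j)) (cong (suc m +_) (toℕ-inject₁ j)))))))

  -- σ carries the last entry of each half to the front of the other half.
  σ-++ : u (fromℕ m) ≡ v (fromℕ n) → σ (u ++ v) ≈ (σ u ++ σ v)
  σ-++ same-last = ++-cases (λ k → σ (u ++ v) k ≡ (σ u ++ σ v) k)
    (trans σ-++-zero (sym same-last))
    (λ i → trans (σ-++ˡ i) (sym (lookup-++ˡ (σ u) (σ v) (suc i))))
    (trans σ-++-middle (trans same-last (sym (lookup-++ʳ (σ u) (σ v) zero))))
    (λ j → trans (σ-++ʳ j) (sym (lookup-++ʳ (σ u) (σ v) (suc j))))

  D-++ : u (fromℕ m) ≡ v (fromℕ n) → D (u ++ v) ≈ (D u ++ D v)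
  D-++ same-last = ≈-trans (⊕-cong {u = u ++ v} ≈-refl (σ-++ same-last)) (++-⊕ u (σ u) v (σ v))

D-𝟙++𝟘 : ∀ {m n} → D (𝟙 {suc m} ++ 𝟘 {suc n}) ≈ (e₀ {suc m} ++ e₀ {suc n})
D-𝟙++𝟘 {m} {n} = ++-cases {m} {n} (λ k → D (𝟙ᵐ ++ 𝟘ⁿ) k ≡ (e₀ᵐ ++ e₀ⁿ) k)
  (cong (true xor_) (σ-++-zero 𝟙ᵐ 𝟘ⁿ))
  (λ i → trans (cong₂ _xor_ (lookup-++ˡ 𝟙ᵐ 𝟘ⁿ (suc i)) (σ-++ˡ 𝟙ᵐ 𝟘ⁿ i)) (sym (lookup-++ˡ e₀ᵐ e₀ⁿ (suc i))))
  (trans (cong₂ _xor_ (lookup-++ʳ 𝟙ᵐ 𝟘ⁿ zero) (σ-++-middle 𝟙ᵐ 𝟘ⁿ)) (sym (lookup-++ʳ e₀ᵐ e₀ⁿ zero)))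
  (λ j → trans (cong₂ _xor_ (lookup-++ʳ 𝟙ᵐ 𝟘ⁿ (suc j)) (σ-++ʳ 𝟙ᵐ 𝟘ⁿ j)) (sym (lookup-++ʳ e₀ᵐ e₀ⁿ (suc j))))
  where
  𝟙ᵐ e₀ᵐ : Vec₂ (suc m)
  𝟙ᵐ = 𝟙
  e₀ᵐ = e₀
  𝟘ⁿ e₀ⁿ : Vec₂ (suc n)
  𝟘ⁿ = 𝟘
  e₀ⁿ = e₀

e₀≈e₀++𝟘 : ∀ {m n} → e₀ ≈ (e₀ {suc m} ++ 𝟘 {n})
e₀≈e₀++𝟘 {m} {n} = ++-ind {suc m} {n} (λ k → e₀ k ≡ (e₀ᵐ ++ 𝟘ⁿ) k) left (λ j → sym (lookup-++ʳ e₀ᵐ 𝟘ⁿ j))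
  where
  e₀ᵐ : Vec₂ (suc m)
  e₀ᵐ = e₀
  𝟘ⁿ : Vec₂ n
  𝟘ⁿ = 𝟘
  left : ∀ i → e₀ (i ↑ˡ n) ≡ (e₀ᵐ ++ 𝟘ⁿ) (i ↑ˡ n)
  left zero    = refl
  left (suc i) = sym (lookup-++ˡ e₀ᵐ 𝟘ⁿ (suc i))

col-block-↑ˡ : ∀ {m} (A : Mat₂ m) j → col (block A) (j ↑ˡ m) ≈ (col A j ++ 𝟘 {m})
col-block-↑ˡ {m} A j i rewrite splitAt-↑ˡ m j m with splitAt m i
... | inj₁ _ = refl
... | inj₂ _ = refl

col-block-↑ʳ : ∀ {m} (A : Mat₂ m) j → col (block A) (m ↑ʳ j) ≈ (col A j ++ col A j)
col-block-↑ʳ {m} A j i rewrite splitAt-↑ʳ m m j with splitAt m i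
... | inj₁ _ = refl
... | inj₂ _ = refl

PascalColumns : ∀ {n} → Mat₂ n → Set
PascalColumns A = ∀ j → col A j ≈ D^ (toℕ j) e₀

PascalLastColumnFull : ℕ → Set
PascalLastColumnFull n = D^ (pred n) (e₀ {n}) ≈ 𝟙

module Doubling {Q : ℕ} (full : PascalLastColumnFull (suc Q)) where

  open ≈-Reasoning

  infixr 5 _∥_
  _∥_ : Vec₂ (suc Q) → Vec₂ (suc Q) → Vec₂ (suc Q + suc Q)
  _∥_ = _++_

  ∥-cong : ∀ {u u′ v v′} → u ≈ u′ → v ≈ v′ → (u ∥ v) ≈ (u′ ∥ v′)
  ∥-cong {u} {u′} = ++-cong u u′

  D^-e₀-lower : ∀ t → t ≤ Q → D^ t e₀ ≈ (D^ t e₀ ∥ 𝟘)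
  D^-e₀-lower zero    _   = e₀≈e₀++𝟘
  D^-e₀-lower (suc t) t<Q = begin
    D (D^ t e₀)          ≈⟨ D-cong (D^-e₀-lower t (<⇒≤ t<Q)) ⟩
    D (D^ t e₀ ∥ 𝟘)      ≈⟨ D-++ (D^ t e₀) 𝟘 (D^-e₀-vanishes t (fromℕ Q) (inj₂ Q>t)) ⟩
    (D (D^ t e₀) ∥ D 𝟘)  ≈⟨ ∥-cong ≈-refl σ-𝟘 ⟩
    (D^ (suc t) e₀ ∥ 𝟘)  ∎
    where
    Q>t : t < toℕ (fromℕ Q)
    Q>t = subst (t <_) (sym (toℕ-fromℕ Q)) t<Q

  -- This is (1 + σ)^P = 1 + σ^P for P a power of 2, evaluated at e₀.
  D^-e₀-middle : D^ (suc Q) e₀ ≈ (e₀ ∥ e₀)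
  D^-e₀-middle = begin
    D (D^ Q e₀)      ≈⟨ D-cong (D^-e₀-lower Q ≤-refl) ⟩
    D (D^ Q e₀ ∥ 𝟘)  ≈⟨ D-cong (∥-cong full ≈-refl) ⟩
    D (𝟙 ∥ 𝟘)        ≈⟨ D-𝟙++𝟘 ⟩
    (e₀ ∥ e₀)        ∎

  D^-∥-twice : ∀ t (u : Vec₂ (suc Q)) → D^ t (u ∥ u) ≈ (D^ t u ∥ D^ t u)
  D^-∥-twice zero    u = ≈-refl
  D^-∥-twice (suc t) u = ≈-trans (D-cong (D^-∥-twice t u)) (D-++ (D^ t u) (D^ t u) refl)

  D^-e₀-upper : ∀ t → D^ (t + suc Q) e₀ ≈ (D^ t e₀ ∥ D^ t e₀)
  D^-e₀-upper t = begin
    D^ (t + suc Q) e₀     ≡⟨ D^-+ t (suc Q) e₀ ⟨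
    D^ t (D^ (suc Q) e₀)  ≈⟨ D^-cong t D^-e₀-middle ⟩
    D^ t (e₀ ∥ e₀)        ≈⟨ D^-∥-twice t e₀ ⟩
    (D^ t e₀ ∥ D^ t e₀)   ∎

  full-double : PascalLastColumnFull (suc Q + suc Q)
  full-double = ≈-trans (D^-e₀-upper Q) (≈-trans (∥-cong full full) (𝟙++𝟙 {suc Q}))

  block-pascal : (A : Mat₂ (suc Q)) → PascalColumns A → PascalColumns (block A)
  block-pascal A cols = ++-ind (λ j → col (block A) j ≈ D^ (toℕ j) e₀) left right
    where
    left : ∀ j → col (block A) (j ↑ˡ suc Q) ≈ D^ (toℕ (j ↑ˡ suc Q)) e₀
    left j = begin
      col (block A) (j ↑ˡ suc Q)  ≈⟨ col-block-↑ˡ A j ⟩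
      (col A j ∥ 𝟘)               ≈⟨ ∥-cong (cols j) ≈-refl ⟩
      (D^ (toℕ j) e₀ ∥ 𝟘)         ≈⟨ D^-e₀-lower (toℕ j) (toℕ≤pred[n] j) ⟨
      D^ (toℕ j) e₀               ≡⟨ cong (λ t → D^ t e₀) (toℕ-↑ˡ j (suc Q)) ⟨
      D^ (toℕ (j ↑ˡ suc Q)) e₀    ∎
    right : ∀ j → col (block A) (suc Q ↑ʳ j) ≈ D^ (toℕ (suc Q ↑ʳ j)) e₀
    right j = begin
      col (block A) (suc Q ↑ʳ j)       ≈⟨ col-block-↑ʳ A j ⟩
      (col A j ∥ col A j)              ≈⟨ ∥-cong (cols j) (cols j) ⟩
      (D^ (toℕ j) e₀ ∥ D^ (toℕ j) e₀)  ≈⟨ D^-e₀-upper (toℕ j) ⟨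
      D^ (toℕ j + suc Q) e₀            ≡⟨ cong (λ t → D^ t e₀) (trans (+-comm (toℕ j) (suc Q)) (sym (toℕ-↑ʳ _ j))) ⟩
      D^ (toℕ (suc Q ↑ʳ j)) e₀         ∎

block-full : ∀ {n} → PascalLastColumnFull n → PascalLastColumnFull (n + n)
block-full {zero}  _    ()
block-full {suc Q} full = Doubling.full-double full

block-pascal : ∀ {n} (A : Mat₂ n) → PascalLastColumnFull n → PascalColumns A → PascalColumns (block A)
block-pascal {zero}  A _    _ ()
block-pascal {suc Q} A full   = Doubling.block-pascal full A

cast-pascal : ∀ {m n} (eq : m ≡ n) (A : Mat₂ n) → PascalColumns A → PascalColumns (λ i j → A (cast eq i) (cast eq j))
cast-pascal refl A cols j i = trans (cong₂ A (cast-is-id refl i) (cast-is-id refl j)) (cols j i)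

M-full : ∀ d → PascalLastColumnFull (2 ^ d)
M-full zero    zero = refl
M-full (suc d) = subst PascalLastColumnFull (cong (2 ^ d +_) (sym (+-identityʳ (2 ^ d)))) (block-full (M-full d))

M-pascal : ∀ d → PascalColumns (M d)
M-pascal zero    zero    zero = refl
M-pascal (suc d) = cast-pascal (cong (2 ^ d +_) (+-identityʳ (2 ^ d))) (block (M d))
                     (block-pascal (M d) (M-full d) (M-pascal d))

σ-unit-inject₁ : ∀ {k} (j : Fin k) → σ (unit (inject₁ j)) ≈ unit (suc j)
σ-unit-inject₁ {k} j zero    = dec-false (inject₁ j ≟ᶠ fromℕ k) (fromℕ≢inject₁ ∘ sym)
σ-unit-inject₁     j (suc i) with j ≟ᶠ i
... | yes j≡i = dec-true (inject₁ j ≟ᶠ inject₁ i) (cong inject₁ j≡i)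
... | no  j≢i = dec-false (inject₁ j ≟ᶠ inject₁ i) (j≢i ∘ inject₁-injective)

σ^-e₀ : ∀ {k} (j : Fin (suc k)) → σ^ (toℕ j) e₀ ≈ unit j
σ^-e₀ j = go (toℕ j) j refl
  where
  go : ∀ {k} t (j : Fin (suc k)) → toℕ j ≡ t → σ^ t e₀ ≈ unit j
  go zero    zero    _ zero    = refl
  go zero    zero    _ (suc i) = refl
  go (suc t) (suc j) e = ≈-trans (σ-cong (go t (inject₁ j) (trans (toℕ-inject₁ j) (suc-injective e))))
                                 (σ-unit-inject₁ j)

D^-e₀-beyond : ∀ {k} → PascalLastColumnFull (suc k) → ∀ t → k < t → D^ t (e₀ {suc k}) ≈ 𝟘
D^-e₀-beyond {k} full t k<t = begin
  D^ t e₀                 ≡⟨ cong (λ s → D^ s e₀) (m∸n+n≡m k<t) ⟨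
  D^ (x + suc k) e₀       ≡⟨ D^-+ x (suc k) e₀ ⟨
  D^ x (D (D^ k e₀))      ≈⟨ D^-cong x (≈-trans (D-cong full) D-𝟙) ⟩
  D^ x 𝟘                  ≈⟨ D^-𝟘 x ⟩
  𝟘                       ∎
  where
  open ≈-Reasoning
  x = t ∸ suc k

shifts : ∀ {n} → Mat₂ n
shifts i j = σ^ (toℕ j) e₀ i

shifts-· : ∀ {k} (y : Vec₂ (suc k)) → (shifts · y) ≈ y
shifts-· y i = trans (sum₂-single _ i off-i) (cong (_∧ y i) (trans (σ^-e₀ i i) (dec-true (i ≟ᶠ i) refl)))
  where
  off-i : ∀ j → j ≢ i → σ^ (toℕ j) e₀ i ∧ y j ≡ false
  off-i j j≢i = cong (_∧ y j) (trans (σ^-e₀ j i) (dec-false (j ≟ᶠ i) j≢i))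

D^-nilpotent : ∀ {k} → PascalLastColumnFull (suc k) → ∀ y → D^ (suc k) y ≈ 𝟘
D^-nilpotent {k} full y = begin
  D^ (suc k) y                       ≈⟨ D^-cong (suc k) (shifts-· y) ⟨
  D^ (suc k) (shifts · y)            ≈⟨ D^-· (suc k) shifts y ⟩
  (mapCols (D^ (suc k)) shifts · y)  ≈⟨ ·-cong y shift-killed ⟩
  ((λ _ _ → false) · y)              ≈⟨ (λ _ → sum₂-𝟘 {suc k} (λ _ → refl)) ⟩
  𝟘                                  ∎
  where
  open ≈-Reasoning
  shift-killed : ∀ j → D^ (suc k) (σ^ (toℕ j) e₀) ≈ 𝟘
  shift-killed j = ≈-trans (D^-σ^ (suc k) (toℕ j) e₀)
                     (≈-trans (σ^-cong (toℕ j) (D^-e₀-beyond full (suc k) ≤-refl)) (σ^-𝟘 (toℕ j)))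

module Invertible {k : ℕ} (A : Mat₂ (suc k))
  (top : ∀ c j → c + toℕ j ≡ k → D^ c (col A j) ≈ 𝟙)
  (beyond : ∀ c j → k < c + toℕ j → D^ c (col A j) ≈ 𝟘)
  (nilpotent : ∀ (y : Vec₂ (suc k)) → D^ (suc k) y ≈ 𝟘) where

  ·-kernel : ∀ w → (A · w) ≈ 𝟘 → w ≈ 𝟘
  ·-kernel w Aw≈𝟘 = All.wfRec <-wellFounded 0ℓ (λ j → w j ≡ false) step
    where
    step : ∀ j → (∀ {i} → toℕ i < toℕ j → w i ≡ false) → w j ≡ false
    step j earlier = begin
      w j                                     ≡⟨ cong (_∧ w j) (top c j c+j≡k zero) ⟨
      D^ c (col A j) zero ∧ w j               ≡⟨ sum₂-single _ j others ⟨
      sum₂ (λ i → D^ c (col A i) zero ∧ w i)  ≡⟨ D^-· c A w zero ⟨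
      D^ c (A · w) zero                       ≡⟨ D^-cong c Aw≈𝟘 zero ⟩
      D^ c 𝟘 zero                             ≡⟨ D^-𝟘 c zero ⟩
      false                                   ∎
      where
      open ≡-Reasoning
      c = k ∸ toℕ j
      c+j≡k : c + toℕ j ≡ k
      c+j≡k = m∸n+n≡m (toℕ≤pred[n] j)
      others : ∀ i → i ≢ j → D^ c (col A i) zero ∧ w i ≡ false
      others i i≢j with <-cmp (toℕ i) (toℕ j)
      ... | tri< i<j _ _ = trans (cong (_ ∧_) (earlier i<j)) (∧-zeroʳ _)
      ... | tri≈ _ i≡j _ = ⊥-elim (i≢j (toℕ-injective i≡j))
      ... | tri> _ _ j<i = cong (_∧ w i) (beyond c i (subst (_< c + toℕ i) c+j≡k (+-monoʳ-< c j<i)) zero)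

  ·-injective : ∀ u v → (A · u) ≈ (A · v) → u ≈ v
  ·-injective u v Au≈Av i = xor≡false⇒≡ (u i) (v i) (·-kernel (u ⊕ v) A[u⊕v]≈𝟘 i)
    where
    A[u⊕v]≈𝟘 : (A · (u ⊕ v)) ≈ 𝟘
    A[u⊕v]≈𝟘 = ≈-trans (·-⊕ A u v) (≈-trans (⊕-cong Au≈Av ≈-refl) (⊕-self (A · v)))

  -- If D^t y ≠ 𝟘 then D^t y ∈ ker D is 𝟙 = D^t (col A j) for j = k - t, so y ⊕ col A j is killed by D^t.
  ·-surjective-on : ∀ t → t ≤ suc k → ∀ y → D^ t y ≈ 𝟘 → Σ (Vec₂ (suc k)) (λ w → (A · w) ≈ y)
  ·-surjective-on zero    _ y y≈𝟘 = 𝟘 , ≈-trans (·-𝟘 A) (≈-sym y≈𝟘)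
  ·-surjective-on (suc t) t<k y Dty≈𝟘 with D^ t y zero in eq
  ... | false = ·-surjective-on t (<⇒≤ t<k) y (λ i → trans (D-kernel-constant (D^ t y) Dty≈𝟘 i) eq)
  ... | true  = proj₁ rest ⊕ unit j , Aw≈y
    where
    j : Fin (suc k)
    j = fromℕ< (s≤s (m∸n≤m k t))
    t+j≡k : t + toℕ j ≡ k
    t+j≡k = trans (cong (t +_) (toℕ-fromℕ< (s≤s (m∸n≤m k t)))) (m+[n∸m]≡n (s≤s⁻¹ t<k))
    D^ty≈𝟙 : D^ t y ≈ 𝟙
    D^ty≈𝟙 i = trans (D-kernel-constant (D^ t y) Dty≈𝟘 i) eq
    y′ = y ⊕ col A j
    D^ty′≈𝟘 : D^ t y′ ≈ 𝟘
    D^ty′≈𝟘 = ≈-trans (D^-⊕ t y (col A j)) (≈-trans (⊕-cong D^ty≈𝟙 (top t j t+j≡k)) (⊕-self 𝟙))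
    rest = ·-surjective-on t (<⇒≤ t<k) y′ D^ty′≈𝟘
    Aw≈y : (A · (proj₁ rest ⊕ unit j)) ≈ y
    Aw≈y i = trans (·-⊕ A (proj₁ rest) (unit j) i)
               (trans (cong₂ _xor_ (proj₂ rest i) (·-unit A j i)) (xor-cancelʳ (y i) (col A j i)))

  ·-surjective : ∀ y → Σ (Vec₂ (suc k)) (λ w → (A · w) ≈ y)
  ·-surjective y = ·-surjective-on (suc k) ≤-refl y (nilpotent y)

suitable-gap : ∀ {k} {ν : Fin (suc k) → ℕ} → Suitable ν →
               ∀ t (i j : Fin (suc k)) → toℕ i + t ≡ toℕ j → ν j ≤ ν i × ν i ≤ t + ν j
suitable-gap s zero i j i+0≡j with toℕ-injective {i = i} {j = j} (trans (sym (+-identityʳ _)) i+0≡j)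
... | refl = ≤-refl , ≤-refl
suitable-gap {k} {ν} s (suc t) i j i+t+1≡j =
  subst (λ i → ν j ≤ ν i × ν i ≤ suc t + ν j) (inject₁-lower₁ i k≢i)
        (≤-trans (proj₁ rest) (proj₁ step) , ≤-trans (proj₂ step) (s≤s (proj₂ rest)))
  where
  i<k : toℕ i < k
  i<k = ≤-trans (s≤s (m≤m+n (toℕ i) t))
                (≤-trans (≤-reflexive (trans (sym (+-suc (toℕ i) t)) i+t+1≡j)) (toℕ≤pred[n] j))
  k≢i : k ≢ toℕ i
  k≢i k≡i = <-irrefl (sym k≡i) i<k
  i′ = lower₁ i k≢i
  step = proj₂ s i′
  rest = suitable-gap s t (suc i′) j (trans (cong (λ x → suc x + t) (toℕ-lower₁ i k≢i))
                                           (trans (sym (+-suc (toℕ i) t)) i+t+1≡j))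

suitable-bound : ∀ {k} {ν : Fin (suc k) → ℕ} → Suitable ν → ∀ j → ν j + toℕ j ≤ k
suitable-bound {k} {ν} s j = subst (ν j + toℕ j ≤_) (m∸n+n≡m j≤k) (+-monoˡ-≤ (toℕ j) ν≤gap)
  where
  j≤k = toℕ≤pred[n] j
  ν≤gap : ν j ≤ k ∸ toℕ j
  ν≤gap = subst (ν j ≤_) (trans (cong (k ∸ toℕ j +_) (proj₁ s)) (+-identityʳ _))
            (proj₂ (suitable-gap s (k ∸ toℕ j) j (fromℕ k) (trans (m+[n∸m]≡n j≤k) (sym (toℕ-fromℕ k)))))

below-last : ∀ {k} (j : Fin (suc k)) → j ≢ fromℕ k → toℕ j < k
below-last {k} j j≢last =
  ≤∧≢⇒< (toℕ≤pred[n] j) (λ j≡k → j≢last (toℕ-injective (trans j≡k (sym (toℕ-fromℕ k)))))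

-- The penultimate entry of ν is 0 or 1, and it bounds all earlier entries from above or below respectively.
suitable-cases : ∀ {k} {ν : Fin (suc k) → ℕ} → Suitable ν →
                 (∀ j → j ≢ fromℕ k → ν j + toℕ j < k) ⊎ (∀ j → j ≢ fromℕ k → 0 < ν j)
suitable-cases {zero}      s = inj₁ λ { zero 0≢0 → ⊥-elim (0≢0 refl) }
suitable-cases {suc k} {ν} s = by-penultimate (ν pen) refl pen≤1
  where
  pen = inject₁ (fromℕ k)
  pen≤1 : ν pen ≤ 1
  pen≤1 = subst (λ x → ν pen ≤ suc x) (proj₁ s) (proj₂ (proj₂ s (fromℕ k)))
  j≤k : ∀ j → j ≢ fromℕ (suc k) → toℕ j ≤ k
  j≤k j j≢last = s≤s⁻¹ (below-last j j≢last)
  gap : ∀ j → j ≢ fromℕ (suc k) → ν pen ≤ ν j × ν j ≤ k ∸ toℕ j + ν pen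
  gap j j≢last = suitable-gap s (k ∸ toℕ j) j pen
                   (trans (m+[n∸m]≡n (j≤k j j≢last)) (sym (trans (toℕ-inject₁ (fromℕ k)) (toℕ-fromℕ k))))
  by-penultimate : ∀ p → ν pen ≡ p → p ≤ 1 →
                   (∀ j → j ≢ fromℕ (suc k) → ν j + toℕ j < suc k) ⊎ (∀ j → j ≢ fromℕ (suc k) → 0 < ν j)
  by-penultimate zero       pen≡0 _ = inj₁ λ j j≢last → s≤s (subst (ν j + toℕ j ≤_) (m∸n+n≡m (j≤k j j≢last))
    (+-monoˡ-≤ (toℕ j) (subst (ν j ≤_) (trans (cong (_ +_) pen≡0) (+-identityʳ _)) (proj₂ (gap j j≢last)))))
  by-penultimate (suc zero) pen≡1 _ = inj₂ λ j j≢last → subst (_≤ ν j) pen≡1 (proj₁ (gap j j≢last))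
  by-penultimate (suc (suc _)) _ (s≤s ())

Dichotomy : (n : ℕ) → Mat₂ n → Set
Dichotomy n A =
    ( ((v : Vec₂ n) → Even v → Even (A · v))
      × ((w : Vec₂ n) → Even w ⇔ Even (A · w)) )
    ⊎
    ( ((v : Vec₂ n) → Even v → FirstZero (A · v))
      × ((u v : Vec₂ n) → Even u → Even v → (A · u) ≈ (A · v) → u ≈ v)
      × ((y : Vec₂ n) → FirstZero y → Σ (Vec₂ n) (λ v → Even v × (A · v) ≈ y))
      × ((w : Vec₂ n) → Even w ⇔ FirstZero (A · w)) )

module ShiftedPascal {k : ℕ} (A : Mat₂ (suc k)) (ν : Fin (suc k) → ℕ) (suitable : Suitable ν)
  (full : PascalLastColumnFull (suc k)) (cols : ∀ j → col A j ≈ σ^ (ν j) (D^ (toℕ j) e₀)) where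

  last = fromℕ k

  col-vanishes : ∀ j → VanishesOutside (col A j) (ν j + 0) (ν j + toℕ j)
  col-vanishes j i out = trans (cols j i) (σ^-vanishes (D^-e₀-vanishes (toℕ j)) (ν j) ν+j≤k i out)
    where
    ν+j≤k : ν j + toℕ j ≤ k
    ν+j≤k = suitable-bound suitable j

  last-col : col A last ≈ 𝟙
  last-col i = trans (cols last i) (trans (cong (λ t → σ^ t (D^ (toℕ last) e₀) i) (proj₁ suitable))
                                          (trans (cong (λ t → D^ t e₀ i) (toℕ-fromℕ k)) (full i)))

  row-picks-last : ∀ r → (∀ j → j ≢ last → A r j ≡ false) → ∀ w → (A · w) r ≡ w last
  row-picks-last r off w = trans (sum₂-single _ last (λ j j≢last → cong (_∧ w j) (off j j≢last)))
                                (cong (_∧ w last) (last-col r))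

  D^-col : ∀ c j → D^ c (col A j) ≈ σ^ (ν j) (D^ (c + toℕ j) e₀)
  D^-col c j = ≈-trans (D^-cong c (cols j))
                 (≈-trans (D^-σ^ c (ν j) (D^ (toℕ j) e₀))
                          (σ^-cong (ν j) (λ i → cong (λ v → v i) (D^-+ c (toℕ j) e₀))))

  D^-col-top : ∀ c j → c + toℕ j ≡ k → D^ c (col A j) ≈ 𝟙
  D^-col-top c j c+j≡k = ≈-trans (D^-col c j)
    (≈-trans (σ^-cong (ν j) (subst (λ t → D^ t (e₀ {suc k}) ≈ 𝟙) (sym c+j≡k) full)) (σ^-𝟙 (ν j)))

  D^-col-beyond : ∀ c j → k < c + toℕ j → D^ c (col A j) ≈ 𝟘
  D^-col-beyond c j k<c+j =
    ≈-trans (D^-col c j) (≈-trans (σ^-cong (ν j) (D^-e₀-beyond full (c + toℕ j) k<c+j)) (σ^-𝟘 (ν j)))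

  open Invertible A D^-col-top D^-col-beyond (D^-nilpotent full)

  even-preserving : (∀ j → j ≢ last → A last j ≡ false) → Dichotomy (suc k) A
  even-preserving off = inj₁ ((λ v v-even → trans (row-picks-last last off v) v-even) ,
    (λ w → mk⇔ (trans (row-picks-last last off w)) (trans (sym (row-picks-last last off w)))))

  even-to-first-zero : (∀ j → j ≢ last → A zero j ≡ false) → Dichotomy (suc k) A
  even-to-first-zero off = inj₂ ((λ v v-even → trans (row-picks-last zero off v) v-even) ,
    (λ u v _ _ → ·-injective u v) ,
    (λ y y₀≡0 → let (w , Aw≈y) = ·-surjective y in
                w , trans (sym (row-picks-last zero off w)) (trans (Aw≈y zero) y₀≡0) , Aw≈y) ,
    (λ w → mk⇔ (trans (row-picks-last zero off w)) (trans (sym (row-picks-last zero off w)))))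

  dichotomy : Dichotomy (suc k) A
  dichotomy with suitable-cases suitable
  ... | inj₁ ν+j<k = even-preserving λ j j≢last →
          col-vanishes j last (inj₂ (subst (ν j + toℕ j <_) (sym (toℕ-fromℕ k)) (ν+j<k j j≢last)))
  ... | inj₂ 0<ν   = even-to-first-zero λ j j≢last →
          col-vanishes j zero (inj₁ (<-≤-trans (0<ν j j≢last) (m≤m+n (ν j) 0)))

shifted-pascal-dichotomy : ∀ {n} (A : Mat₂ n) (ν : Fin n → ℕ) → Suitable ν → PascalLastColumnFull n →
                           (∀ j → col A j ≈ σ^ (ν j) (D^ (toℕ j) e₀)) → Dichotomy n A
shifted-pascal-dichotomy {zero}  A ν _ _ _ = inj₁ ((λ _ _ → tt) , λ _ → mk⇔ (λ _ → tt) (λ _ → tt))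
shifted-pascal-dichotomy {suc k} A ν suitable full cols = ShiftedPascal.dichotomy A ν suitable full cols

lemma6 : (d : ℕ) (ν : Fin (2 ^ d) → ℕ) → Suitable ν →
    ( ((v : Vec₂ (2 ^ d)) → Even v → Even (Mν d ν · v))
      × ((w : Vec₂ (2 ^ d)) → Even w ⇔ Even (Mν d ν · w)) )
    ⊎
    ( ((v : Vec₂ (2 ^ d)) → Even v → FirstZero (Mν d ν · v))
      × ((u v : Vec₂ (2 ^ d)) → Even u → Even v → (Mν d ν · u) ≈ (Mν d ν · v) → u ≈ v)
      × ((y : Vec₂ (2 ^ d)) → FirstZero y → Σ (Vec₂ (2 ^ d)) (λ v → Even v × (Mν d ν · v) ≈ y))
      × ((w : Vec₂ (2 ^ d)) → Even w ⇔ FirstZero (Mν d ν · w)) )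
lemma6 d ν suitable =
  shifted-pascal-dichotomy (Mν d ν) ν suitable (M-full d) (λ j → σ^-cong (ν j) (M-pascal d j))
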